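{- Let $G$ be a connected chordal graph, let $K\subseteq G$ be a clique, let $C$ be a component of $G-K$, and let $S=N(C)$. If $G$ contains no strict comb of cliques, then $C$ contains a vertex $v$ with $N_S(v)=S$.
   Context: A graph is chordal if it has no induced cycle of length at least four. $N(C)$ denotes the set of vertices outside $C$ having a neighbour in $C$; for a vertex $v$ and a set $S$, $N_S(v)=N(v)\cap S$. A strict comb of cliques in $G$ consists of a countably infinite clique $\{v_i : i\in\mathbb N\}$ together with, for each $i>1$, a vertex adjacent to all of $v_1,\dots,v_{i-1}$ but to none of $v_i,v_{i+1},\dots$. -}

module Defs where

open import Data.Nat using (ℕ; zero; suc; _≤_; _<_)
open import Data.Fin using (Fin; toℕ)
open import Data.Product using (Σ; ∃; _×_; _,_)
open import Data.Sum using (_⊎_)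
open import Data.Empty using (⊥)
open import Relation.Nullary using (¬_)
open import Relation.Binary.PropositionalEquality using (_≡_; _≢_)
open import Function.Definitions using (Injective)

record Graph : Set₁ where
  field
    V     : Set
    _~_   : V → V → Set
    irrefl : ∀ {x} → ¬ (x ~ x)
    sym~   : ∀ {x y} → x ~ y → y ~ x

module _ (G : Graph) where
  open Graph G

  VSet : Set₁
  VSet = V → Set

  IsClique : VSet → Set
  IsClique K = ∀ x y → K x → K y → x ≢ y → x ~ y

  data Reach (K : VSet) : V → V → Set where
    here : ∀ {a} → ¬ K a → Reach K a a
    step : ∀ {a b c} → Reach K a b → b ~ c → ¬ K c → Reach K a c

  ∅ : VSet
  ∅ _ = ⊥

  Connected : Set
  Connected = V × (∀ x y → Reach ∅ x y)

  IsComponentOfMinus : VSet → VSet → Set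
  IsComponentOfMinus K C =
    Σ V λ c → ¬ K c × (∀ x → (C x → Reach K c x) × (Reach K c x → C x))

  Nbhd : VSet → VSet
  Nbhd C x = ¬ C x × Σ V (λ y → C y × (y ~ x))

  N[_] : VSet → V → VSet
  N[ S ] v x = (v ~ x) × S x

  _≐_ : VSet → VSet → Set
  A ≐ B = ∀ x → (A x → B x) × (B x → A x)

  Consec : (n : ℕ) → Fin n → Fin n → Set
  Consec n i j = (suc (toℕ i) ≡ toℕ j) ⊎ ((suc (toℕ i) ≡ n) × (toℕ j ≡ 0))

  IsInducedCycle : (n : ℕ) → (Fin n → V) → Set
  IsInducedCycle n f =
    Injective _≡_ _≡_ f
    × (∀ i j → Consec n i j → f i ~ f j)
    × (∀ i j → f i ~ f j → Consec n i j ⊎ Consec n j i)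

  Chordal : Set
  Chordal = ¬ (Σ ℕ λ n → 4 ≤ n × Σ (Fin n → V) λ f → IsInducedCycle n f)

  -- strict comb of cliques (0-indexed): an injective sequence v forming a
  -- clique, and for every i a vertex w i adjacent to v 0, …, v i and to none
  -- of v (i+1), v (i+2), …  (w i is the paper's vertex for index i+2,
  -- with the paper's v_k being v (k-1)).
  StrictComb : Set
  StrictComb =
    Σ (ℕ → V) λ v → Σ (ℕ → V) λ w →
      Injective _≡_ _≡_ v
      × (∀ i j → i ≢ j → v i ~ v j)
      × (∀ i j → j ≤ i → w i ~ v j)
      × (∀ i j → i < j → ¬ (w i ~ v j))

{-# OPTIONS --safe #-}
-- Write S = N(C).  Every vertex of S lies in K (otherwise it would belong to C), so S is a clique.
-- Key step: for v ∈ C and s ∈ S, let u be the last vertex before s on a shortest walk from v to s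
-- through C.  Then u ~ s and N_S(v) ⊆ N(u): if t ∈ N_S(v) were not adjacent to u, the last vertex
-- of the walk adjacent to t, the rest of the walk up to s, and t itself would form an induced cycle
-- of length at least 4.  If no vertex of C saw all of S, iterating this step, each time towards a
-- vertex s_i ∈ S missed by the current u_i, would give u_{i+1} ~ s_i ≁ u_i with N_S(u_i) growing,
-- and then the s_i together with the u_{i+1} form a strict comb of cliques.
module Submission where

open import Defs
open import Level using (0ℓ)
open import Axiom.DoubleNegationElimination using (DoubleNegationElimination; em⇒dne)
open import Axiom.ExcludedMiddle using (ExcludedMiddle)
open import Data.Empty using (⊥-elim)
open import Data.Fin using (toℕ)
open import Data.Fin.Properties using (toℕ-injective; toℕ<n)
open import Data.Nat using (ℕ; zero; suc; _+_; _≤_; _<_; _≤′_; ≤′-refl; ≤′-step; z≤n; s≤s; _≤?_)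
open import Data.Nat.GeneralisedArithmetic using (fold)
open import Data.Nat.Induction using (<-wellFounded)
open import Data.Nat.Properties
open import Algebra.Properties.CommutativeSemigroup +-commutativeSemigroup using (xy∙z≈xz∙y)
open import Data.Product using (Σ; ∃; ∃₂; _×_; _,_; proj₁; proj₂)
open import Data.Sum using (_⊎_; inj₁; inj₂)
open import Function using (_∘_; id)
open import Induction.WellFounded using (Acc; acc)
open import Relation.Binary using (tri<; tri≈; tri>)
open import Relation.Binary.PropositionalEquality using (_≡_; _≢_; refl; sym; trans; cong; subst; subst₂)
open import Relation.Nullary using (¬_; yes; no)
open import Relation.Unary using (Decidable)

_◂_ : {A : Set} → A → (ℕ → A) → ℕ → A
(x ◂ f) zero    = x
(x ◂ f) (suc i) = f i

minimal-witness : ExcludedMiddle 0ℓ → {P : ℕ → Set} → ∀ {n} → P n →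
                  ∃ λ m → P m × (∀ {k} → k < m → ¬ P k)
minimal-witness em {P} {n} = search (<-wellFounded n)
  where
  search : ∀ {n} → Acc _<_ n → P n → ∃ λ m → P m × (∀ {k} → k < m → ¬ P k)
  search {n} (acc smaller) pn with em {∃ λ k → k < n × P k}
  ... | yes (k , k<n , pk) = search (smaller k<n) pk
  ... | no  none           = n , pn , λ k<n pk → none (_ , k<n , pk)

last-before : {P : ℕ → Set} → Decidable P → ∀ {k} → P 0 → ¬ P k →
              ∃₂ λ d j → k ≡ suc d + j × P j × (∀ {i} → j < i → i ≤ k → ¬ P i)
last-before P? {zero} p0 ¬pk = ⊥-elim (¬pk p0)
last-before {P} P? {suc k} p0 ¬p1+k with P? k
... | yes pk = 0 , k , refl , pk , λ k<i i≤1+k → subst (¬_ ∘ P) (sym (≤-antisym i≤1+k k<i)) ¬p1+k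
... | no ¬pk with last-before P? p0 ¬pk
...   | d , j , k≡1+d+j , pj , after = suc d , j , cong suc k≡1+d+j , pj , after′
  where
  after′ : ∀ {i} → j < i → i ≤ suc k → ¬ P i
  after′ j<i i≤1+k with m≤n⇒m<n∨m≡n i≤1+k
  ... | inj₁ i<1+k = after j<i (≤-pred i<1+k)
  ... | inj₂ refl  = ¬p1+k

module _ (G : Graph) where
  open Graph G

  -- Only the vertices before the last are required to lie in P, so a walk through a
  -- component may end in its neighbourhood.
  record Walk (P : VSet G) (x y : V) (n : ℕ) : Set where
    field
      vertex : ℕ → V
      source : vertex 0 ≡ x
      target : vertex n ≡ y
      edge   : ∀ {i} → i < n → vertex i ~ vertex (suc i)
      inside : ∀ {i} → i < n → P (vertex i)
  open Walk

  stay : ∀ {P} x → Walk P x x 0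
  stay x = record
    { vertex = λ _ → x ; source = refl ; target = refl ; edge = λ () ; inside = λ () }

  cons : ∀ {P x y z n} → P x → x ~ y → Walk P y z n → Walk P x z (suc n)
  cons {x = x} x∈P x~y w = record
    { vertex = x ◂ vertex w
    ; source = refl
    ; target = target w
    ; edge   = λ { {zero} _ → subst (x ~_) (sym (source w)) x~y ; {suc i} (s≤s i<n) → edge w i<n }
    ; inside = λ { {zero} _ → x∈P ; {suc i} (s≤s i<n) → inside w i<n }
    }

  Shortest : VSet G → V → V → ℕ → Set
  Shortest P x y n = ∀ {m} → m < n → ¬ Walk P x y m

  module _ {P x y N} (w : Walk P x y N) where

    skip : ℕ → ℕ → ℕ → V
    skip a e i with i ≤? a
    ... | yes _ = vertex w i
    ... | no  _ = vertex w (i + e)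

    skip-≤ : ∀ {a e i} → i ≤ a → skip a e i ≡ vertex w i
    skip-≤ {a} {e} {i} i≤a with i ≤? a
    ... | yes _   = refl
    ... | no  i≰a = ⊥-elim (i≰a i≤a)

    skip-> : ∀ {a e i} → a < i → skip a e i ≡ vertex w (i + e)
    skip-> {a} {e} {i} a<i with i ≤? a
    ... | yes i≤a = ⊥-elim (<⇒≱ a<i i≤a)
    ... | no  _   = refl

    shortcut : ∀ {n a} e → N ≡ n + e → a < n → vertex w a ~ vertex w (suc (a + e)) → Walk P x y n
    shortcut {n} {a} e N≡n+e a<n a~a+1+e = record
      { vertex = skip a e
      ; source = trans (skip-≤ {a} {e} z≤n) (source w)
      ; target = trans (skip-> a<n) (trans (cong (vertex w) (sym N≡n+e)) (target w))
      ; edge   = edge′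
      ; inside = inside′
      }
      where
      n≤N : n ≤ N
      n≤N = subst (n ≤_) (sym N≡n+e) (m≤m+n n e)
      shifted : ∀ {i} → i < n → i + e < N
      shifted i<n = subst (_ <_) (sym N≡n+e) (+-monoˡ-< e i<n)
      edge′ : ∀ {i} → i < n → skip a e i ~ skip a e (suc i)
      edge′ {i} i<n with <-cmp i a
      ... | tri< i<a _ _  =
        subst₂ _~_ (sym (skip-≤ (<⇒≤ i<a))) (sym (skip-≤ i<a)) (edge w (<-≤-trans i<n n≤N))
      ... | tri≈ _ refl _ =
        subst₂ _~_ (sym (skip-≤ ≤-refl)) (sym (skip-> (n<1+n a))) a~a+1+e
      ... | tri> _ _ a<i  =
        subst₂ _~_ (sym (skip-> a<i)) (sym (skip-> (m<n⇒m<1+n a<i))) (edge w (shifted i<n))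
      inside′ : ∀ {i} → i < n → P (skip a e i)
      inside′ {i} i<n with i ≤? a
      ... | yes _ = inside w (<-≤-trans i<n n≤N)
      ... | no  _ = inside w (shifted i<n)

  Chordless : ℕ → (ℕ → V) → Set
  Chordless n p = ∀ {i j} → i < j → j ≤ n → p i ~ p j → j ≡ suc i

  shortest⇒chordless : ∀ {P x y n} (w : Walk P x y n) → Shortest P x y n → Chordless n (vertex w)
  shortest⇒chordless w shortest {i} i<j j≤n i~j
    with m≤n⇒∃[o]m+o≡n i<j | m≤n⇒∃[o]m+o≡n j≤n
  ... | zero  , refl | _ , refl = cong suc (+-identityʳ i)
  ... | suc d , refl | r , refl =
    ⊥-elim (shortest shorter (shortcut w (suc d) reorder (s≤s (m≤m+n i r)) i~j))
    where
    reorder : suc i + suc d + r ≡ suc i + r + suc d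
    reorder = xy∙z≈xz∙y (suc i) (suc d) r
    shorter : suc i + r < suc i + suc d + r
    shorter = subst (suc i + r <_) (sym reorder) (m<m+n (suc i + r) (s≤s z≤n))

  chordless⇒distinct : ∀ {n p} → (∀ {i} → i < n → p i ~ p (suc i)) → Chordless n p →
                       (∀ {i} → i < n → p i ≢ p n) → ∀ {i j} → i < j → j ≤ n → p i ≢ p j
  chordless⇒distinct {p = p} adjacent chordless ≢last {i} {j} i<j j≤n pi≡pj with m≤n⇒m<n∨m≡n j≤n
  ... | inj₂ refl = ≢last i<j pi≡pj
  ... | inj₁ j<n  = <-irrefl (sym (suc-injective chord)) i<j
    where
    chord : suc j ≡ suc i
    chord = chordless (m<n⇒m<1+n i<j) j<n (subst (_~ p (suc j)) (sym pi≡pj) (adjacent j<n))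

  record IsInducedPath (n : ℕ) (p : ℕ → V) : Set where
    field
      adjacent  : ∀ {i} → i < n → p i ~ p (suc i)
      chordless : Chordless n p
      distinct  : ∀ {i j} → i < j → j ≤ n → p i ≢ p j
  open IsInducedPath

  shortest⇒induced : ∀ {P x y n} (w : Walk P x y n) → Shortest P x y n →
                     (∀ {i} → i < n → vertex w i ≢ y) → IsInducedPath n (vertex w)
  shortest⇒induced w shortest ≢y = record
    { adjacent  = edge w
    ; chordless = shortest⇒chordless w shortest
    ; distinct  = chordless⇒distinct (edge w) (shortest⇒chordless w shortest)
                    (λ i<n eq → ≢y i<n (trans eq (target w)))
    }

  induced-suffix : ∀ {m j p} → IsInducedPath (m + j) p → IsInducedPath m (λ i → p (i + j))
  induced-suffix {j = j} path = record
    { adjacent  = λ i<m → adjacent path (+-monoˡ-< j i<m)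
    ; chordless = λ {i} {i′} i<i′ i′≤m i~i′ →
        +-cancelʳ-≡ j i′ (suc i) (chordless path (+-monoˡ-< j i<i′) (+-monoˡ-≤ j i′≤m) i~i′)
    ; distinct  = λ i<i′ i′≤m → distinct path (+-monoˡ-< j i<i′) (+-monoˡ-≤ j i′≤m)
    }

  module _ {n p x} (path : IsInducedPath n p) (x~first : x ~ p 0) (x~last : x ~ p n)
           (x≁inner : ∀ {i} → 0 < i → i < n → ¬ x ~ p i) (x∉path : ∀ {i} → i ≤ n → x ≢ p i) where

    private
      N : ℕ
      N = suc (suc n)

      CyclicSucc : ℕ → ℕ → Set
      CyclicSucc i j = suc i ≡ j ⊎ (suc i ≡ N × j ≡ 0)

    apex-injective : ∀ {i j} → i < N → j < N → (x ◂ p) i ≡ (x ◂ p) j → i ≡ j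
    apex-injective {zero}  {zero}  _ _ _ = refl
    apex-injective {zero}  {suc j} _ (s≤s (s≤s j≤n)) eq = ⊥-elim (x∉path j≤n eq)
    apex-injective {suc i} {zero}  (s≤s (s≤s i≤n)) _ eq = ⊥-elim (x∉path i≤n (sym eq))
    apex-injective {suc i} {suc j} (s≤s (s≤s i≤n)) (s≤s (s≤s j≤n)) eq with <-cmp i j
    ... | tri< i<j _ _ = ⊥-elim (distinct path i<j j≤n eq)
    ... | tri≈ _ i≡j _ = cong suc i≡j
    ... | tri> _ _ j<i = ⊥-elim (distinct path j<i i≤n (sym eq))

    apex-adjacent : ∀ {i j} → j < N → CyclicSucc i j → (x ◂ p) i ~ (x ◂ p) j
    apex-adjacent {zero}  _ (inj₁ refl) = x~first
    apex-adjacent {suc i} (s≤s (s≤s i<n)) (inj₁ refl) = adjacent path i<n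
    apex-adjacent _ (inj₂ (refl , refl)) = sym~ x~last

    apex-neighbours : ∀ {j} → j ≤ n → x ~ p j → j ≡ 0 ⊎ j ≡ n
    apex-neighbours {zero}  _ _ = inj₁ refl
    apex-neighbours {suc j} j≤n x~j with m≤n⇒m<n∨m≡n j≤n
    ... | inj₁ j<n = ⊥-elim (x≁inner (s≤s z≤n) j<n x~j)
    ... | inj₂ j≡n = inj₂ j≡n

    apex-chord : ∀ {i j} → i < N → j < N → (x ◂ p) i ~ (x ◂ p) j → CyclicSucc i j ⊎ CyclicSucc j i
    apex-chord {zero}  {zero}  _ _ x~x = ⊥-elim (irrefl x~x)
    apex-chord {zero}  {suc j} _ (s≤s (s≤s j≤n)) x~j with apex-neighbours j≤n x~j
    ... | inj₁ refl = inj₁ (inj₁ refl)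
    ... | inj₂ refl = inj₂ (inj₂ (refl , refl))
    apex-chord {suc i} {zero}  (s≤s (s≤s i≤n)) _ i~x with apex-neighbours i≤n (sym~ i~x)
    ... | inj₁ refl = inj₂ (inj₁ refl)
    ... | inj₂ refl = inj₁ (inj₂ (refl , refl))
    apex-chord {suc i} {suc j} (s≤s (s≤s i≤n)) (s≤s (s≤s j≤n)) i~j with <-cmp i j
    ... | tri< i<j _ _ = inj₁ (inj₁ (cong suc (sym (chordless path i<j j≤n i~j))))
    ... | tri≈ _ refl _ = ⊥-elim (irrefl i~j)
    ... | tri> _ _ j<i = inj₂ (inj₁ (cong suc (sym (chordless path j<i i≤n (sym~ i~j)))))

    path+apex⇒inducedCycle : IsInducedCycle G (suc (suc n)) (λ i → (x ◂ p) (toℕ i))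
    path+apex⇒inducedCycle =
        (λ eq → toℕ-injective (apex-injective (toℕ<n _) (toℕ<n _) eq))
      , (λ _ b → apex-adjacent (toℕ<n b))
      , (λ a b → apex-chord (toℕ<n a) (toℕ<n b))

  extending-chain⇒comb : ∀ {S P : VSet G} {x₀} → IsClique G S → P x₀ →
    (∀ {v} → P v → ∃ λ s → S s × ¬ v ~ s) →
    (∀ {v s} → P v → S s → ∃ λ u → P u × u ~ s × (∀ {t} → S t → v ~ t → u ~ t)) →
    StrictComb G
  extending-chain⇒comb {S} {P} {x₀} S-clique x₀∈P miss extend =
      missed , u ∘ suc , missed-injective
    , (λ i j i≢j → S-clique _ _ (missed∈S i) (missed∈S j) (i≢j ∘ missed-injective))
    , (λ i j j≤i → keeps-later (s≤s j≤i) (missed∈S j) (sees-missed j))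
    , (λ i j i<j → misses j ∘ keeps-later i<j (missed∈S j))
    where
    next : Σ V P → Σ V P
    next (v , v∈P) = let u , u∈P , _ = extend v∈P (proj₁ (proj₂ (miss v∈P))) in u , u∈P

    chain : ℕ → Σ V P
    chain = fold (x₀ , x₀∈P) next

    u : ℕ → V
    u = proj₁ ∘ chain

    missed : ℕ → V
    missed i = proj₁ (miss (proj₂ (chain i)))

    missed∈S : ∀ i → S (missed i)
    missed∈S i = proj₁ (proj₂ (miss (proj₂ (chain i))))

    misses : ∀ i → ¬ u i ~ missed i
    misses i = proj₂ (proj₂ (miss (proj₂ (chain i))))

    sees-missed : ∀ i → u (suc i) ~ missed i
    sees-missed i = proj₁ (proj₂ (proj₂ (extend (proj₂ (chain i)) (missed∈S i))))

    keeps : ∀ i {t} → S t → u i ~ t → u (suc i) ~ t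
    keeps i = proj₂ (proj₂ (proj₂ (extend (proj₂ (chain i)) (missed∈S i))))

    keeps-later′ : ∀ {i j} → i ≤′ j → ∀ {t} → S t → u i ~ t → u j ~ t
    keeps-later′ ≤′-refl             _   = id
    keeps-later′ (≤′-step {j} i≤′j) t∈S = keeps j t∈S ∘ keeps-later′ i≤′j t∈S

    keeps-later : ∀ {i j} → i ≤ j → ∀ {t} → S t → u i ~ t → u j ~ t
    keeps-later = keeps-later′ ∘ ≤⇒≤′

    missed-injective : ∀ {i j} → missed i ≡ missed j → i ≡ j
    missed-injective {i} {j} eq with <-cmp i j
    ... | tri< i<j _ _ =
      ⊥-elim (misses j (keeps-later i<j (missed∈S j) (subst (u (suc i) ~_) eq (sees-missed i))))
    ... | tri≈ _ i≡j _ = i≡j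
    ... | tri> _ _ j<i =
      ⊥-elim (misses i (keeps-later j<i (missed∈S i) (subst (u (suc j) ~_) (sym eq) (sees-missed j))))

module Component (em : ExcludedMiddle 0ℓ) (G : Graph) (chordal : Chordal G)
                 (K : VSet G) (K-clique : IsClique G K)
                 (C : VSet G) (component : IsComponentOfMinus G K C) where
  open Graph G
  open Walk

  private
    S : VSet G
    S = Nbhd G C

    dne : DoubleNegationElimination 0ℓ
    dne = em⇒dne em

  root : V
  root = proj₁ component

  reach⇒C : ∀ {x} → Reach G K root x → C x
  reach⇒C = proj₂ (proj₂ (proj₂ component) _)

  C⇒reach : ∀ {x} → C x → Reach G K root x
  C⇒reach = proj₁ (proj₂ (proj₂ component) _)

  root∈C : C root
  root∈C = reach⇒C (here (proj₁ (proj₂ component)))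

  S⊆K : ∀ {s} → S s → K s
  S⊆K (s∉C , y , y∈C , y~s) = dne λ s∉K → s∉C (reach⇒C (step (C⇒reach y∈C) y~s s∉K))

  S-clique : IsClique G S
  S-clique s t s∈S t∈S = K-clique s t (S⊆K s∈S) (S⊆K t∈S)

  restart : ∀ {x x′ z n} → C x → C x′ → Walk G C x z n → ∃ (Walk G C x′ z)
  restart x∈C x′∈C w = let _ , w₀ = from-root (C⇒reach x∈C) w in to-root (C⇒reach x′∈C) w₀
    where
    from-root : ∀ {x z n} → Reach G K root x → Walk G C x z n → ∃ (Walk G C root z)
    from-root (here _)       w = _ , w
    from-root (step r b~x _) w = from-root r (cons G (reach⇒C r) b~x w)
    to-root : ∀ {x z n} → Reach G K root x → Walk G C root z n → ∃ (Walk G C x z)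
    to-root (here _)         w = _ , w
    to-root (step r b~x x∉K) w = let _ , w′ = to-root r w in
      _ , cons G (reach⇒C (step r b~x x∉K)) (sym~ b~x) w′

  walk-to-neighbour : ∀ {v s} → C v → S s → ∃ (Walk G C v s)
  walk-to-neighbour v∈C (_ , y , y∈C , y~s) = restart y∈C v∈C (cons G y∈C y~s (stay G _))

  shortest-keeps-neighbours : ∀ {v s k} (w : Walk G C v s (suc k)) → Shortest G C v s (suc k) →
                              S s → ∀ {t} → S t → v ~ t → ¬ ¬ vertex w k ~ t
  shortest-keeps-neighbours {s = s} {k} w shortest s∈S {t} t∈S v~t u≁t
    with last-before {λ i → vertex w i ~ t} (λ _ → em) {k} (subst (_~ t) (sym (source w)) v~t) u≁t
  ... | d , j , refl , j~t , after =
    chordal (_ , s≤s (s≤s (s≤s (s≤s z≤n))) , _ ,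
             path+apex⇒inducedCycle G tail (sym~ j~t) t~end t≁inner t∉tail)
    where
    path : IsInducedPath G (suc (suc d + j)) (vertex w)
    path = shortest⇒induced G w shortest (λ i<n eq → proj₁ s∈S (subst C eq (inside w i<n)))

    tail : IsInducedPath G (suc (suc d)) (λ i → vertex w (i + j))
    tail = induced-suffix G path

    t≢s : t ≢ s
    t≢s t≡s = u≁t (subst (vertex w (suc d + j) ~_) (trans (target w) (sym t≡s)) (edge w ≤-refl))

    t~end : t ~ vertex w (suc (suc d + j))
    t~end = subst (t ~_) (sym (target w)) (S-clique t s t∈S s∈S t≢s)

    t≁inner : ∀ {i} → 0 < i → i < suc (suc d) → ¬ t ~ vertex w (i + j)
    t≁inner 0<i i<m t~i = after (m<n+m j 0<i) (+-monoˡ-≤ j (≤-pred i<m)) (sym~ t~i)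

    t∉tail : ∀ {i} → i ≤ suc (suc d) → t ≢ vertex w (i + j)
    t∉tail i≤m t≡i with m≤n⇒m<n∨m≡n i≤m
    ... | inj₁ i<m  = proj₁ t∈S (subst C (sym t≡i) (inside w (+-monoˡ-< j i<m)))
    ... | inj₂ refl = t≢s (trans t≡i (target w))

  extend-neighbourhood : ∀ {v s} → C v → S s → ∃ λ u → C u × u ~ s × (∀ {t} → S t → v ~ t → u ~ t)
  extend-neighbourhood {v} {s} v∈C s∈S
    with minimal-witness em {Walk G C v s} (proj₂ (walk-to-neighbour v∈C s∈S))
  ... | zero  , w , _        = ⊥-elim (proj₁ s∈S (subst C (trans (sym (source w)) (target w)) v∈C))
  ... | suc k , w , shortest =
    vertex w k , inside w ≤-refl , subst (vertex w k ~_) (target w) (edge w ≤-refl) ,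
    λ t∈S v~t → dne (shortest-keeps-neighbours w shortest s∈S t∈S v~t)

  some-missed : ¬ (Σ V λ v → C v × (_≐_ G (N[_] G S v) S)) → ∀ {v} → C v → ∃ λ s → S s × ¬ v ~ s
  some-missed ¬goal {v} v∈C = dne λ none →
    ¬goal (v , v∈C , λ x → proj₂ , λ x∈S → dne (λ v≁x → none (x , x∈S , v≁x)) , x∈S)

corollary2p2 : ExcludedMiddle 0ℓ → (G : Graph) → Connected G → Chordal G
    → (K : Graph.V G → Set) → IsClique G K
    → (C : Graph.V G → Set) → IsComponentOfMinus G K C
    → ¬ StrictComb G
    → Σ (Graph.V G) λ v → C v × (_≐_ G (N[_] G (Nbhd G C) v) (Nbhd G C))
corollary2p2 em G _ chordal K K-clique C component ¬comb = em⇒dne em λ ¬goal →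
  ¬comb (extending-chain⇒comb G S-clique root∈C (some-missed ¬goal) extend-neighbourhood)
  where open Component em G chordal K K-clique C component
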